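{- The Diophantine equation $3^{x}-1=L_{r}$ in nonnegative integers $r,x$ has only the solution $(r,x)=(0,1)$.
   Context: $(L_n)_{n\ge0}$ is the Lucas sequence: $L_0=2$, $L_1=1$, $L_n=L_{n-1}+L_{n-2}$ for $n\ge 2$. -}

module Defs where

open import Data.Nat using (ℕ; zero; suc; _+_)

L : ℕ → ℕ
L zero = 2
L (suc zero) = 1
L (suc (suc n)) = L (suc n) + L n

module Submission where

-- The argument is a congruence obstruction modulo 18.
--   * For x ≥ 2 we have 3^x ≡ 9 (mod 18), hence 3^x - 1 ≡ 8 (mod 18).
--   * The Lucas sequence modulo 18 is periodic with period 24: the pair of
--     residues (L_0, L_1) recurs at (L_24, L_25), and the recurrence then
--     forces every later residue to recur.  None of L_0, ..., L_23 is
--     ≡ 8 (mod 18), a finite decidable check, so L_r ≢ 8 (mod 18) for all r.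
--   * For x ≤ 1 the equation reads L_r = 0 or L_r = 2; since L_1 = 1 and
--     L_n ≥ 3 for n ≥ 2, the first is impossible and the second forces r = 0.
-- The periodicity lemmas are proved for an arbitrary modulus and period;
-- the theorem is assembled from the three facts above at the end.

open import Defs
open import Data.Nat using (ℕ; zero; suc; _+_; _*_; _^_; _∸_; _%_; _/_; _<_; _≤_; _≟_; NonZero; z≤n; s≤s)
open import Data.Nat.Properties using (≤-refl; ≤-trans; n≤1+n; m≤m+n; +-identityʳ; +-assoc; +-comm; allUpTo?)
open import Data.Nat.DivMod using (m≡m%n+[m/n]*n; [m+kn]%n≡m%n; %-distribˡ-+; %-distribˡ-*; m%n<n; m<n⇒m%n≡m)
open import Data.Product using (_×_; _,_; proj₁; proj₂)
open import Data.Empty using (⊥-elim)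
open import Relation.Nullary using (¬?)
open import Relation.Nullary.Decidable using (toWitness)
open import Relation.Binary.PropositionalEquality using (_≡_; _≢_; refl; sym; trans; cong; cong₂; subst; module ≡-Reasoning)
open import Function.Bundles using (_⇔_; mk⇔)

L-≥3 : ∀ n → 3 ≤ L (2 + n)
L-≥3 zero = ≤-refl
L-≥3 (suc zero) = s≤s (s≤s (s≤s z≤n))
L-≥3 (suc (suc n)) = ≤-trans (L-≥3 (suc n)) (m≤m+n (L (3 + n)) (L (2 + n)))

L≢0 : ∀ r → L r ≢ 0
L≢0 zero ()
L≢0 (suc zero) ()
L≢0 (suc (suc n)) e with subst (3 ≤_) e (L-≥3 n)
... | ()

L≡2⇒r≡0 : ∀ r → L r ≡ 2 → r ≡ 0
L≡2⇒r≡0 zero _ = refl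
L≡2⇒r≡0 (suc zero) ()
L≡2⇒r≡0 (suc (suc n)) e with subst (3 ≤_) e (L-≥3 n)
... | s≤s (s≤s ())

IsPeriodMod : (m p : ℕ) .{{_ : NonZero m}} → Set
IsPeriodMod m p = (L p % m ≡ L 0 % m) × (L (suc p) % m ≡ L 1 % m)

module _ (m : ℕ) .{{_ : NonZero m}} {p : ℕ} (period : IsPeriodMod m p) where
  open ≡-Reasoning

  -- Shifting the index by one period does not change the residue: both
  -- sides obey the Lucas recurrence modulo m and agree at n = 0 and n = 1.
  L-shift-mod : ∀ n → L (n + p) % m ≡ L n % m
  L-shift-mod zero = proj₁ period
  L-shift-mod (suc zero) = proj₂ period
  L-shift-mod (suc (suc n)) = begin
    (L (suc n + p) + L (n + p)) % m            ≡⟨ %-distribˡ-+ (L (suc n + p)) (L (n + p)) m ⟩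
    (L (suc n + p) % m + L (n + p) % m) % m    ≡⟨ cong₂ (λ a b → (a + b) % m) (L-shift-mod (suc n)) (L-shift-mod n) ⟩
    (L (suc n) % m + L n % m) % m              ≡⟨ %-distribˡ-+ (L (suc n)) (L n) m ⟨
    (L (suc n) + L n) % m                      ∎

  L-shift-many-mod : ∀ q n → L (n + q * p) % m ≡ L n % m
  L-shift-many-mod zero n = cong (λ k → L k % m) (+-identityʳ n)
  L-shift-many-mod (suc q) n = begin
    L (n + (p + q * p)) % m    ≡⟨ cong (λ k → L k % m) (regroup n p (q * p)) ⟩
    L (n + q * p + p) % m      ≡⟨ L-shift-mod (n + q * p) ⟩
    L (n + q * p) % m          ≡⟨ L-shift-many-mod q n ⟩
    L n % m                    ∎
    where
    regroup : ∀ a b c → a + (b + c) ≡ a + c + b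
    regroup a b c = trans (cong (a +_) (+-comm b c)) (sym (+-assoc a c b))

  L-mod-period : .{{_ : NonZero p}} → ∀ n → L n % m ≡ L (n % p) % m
  L-mod-period n = begin
    L n % m                            ≡⟨ cong (λ k → L k % m) (m≡m%n+[m/n]*n n p) ⟩
    L (n % p + (n / p) * p) % m        ≡⟨ L-shift-many-mod (n / p) (n % p) ⟩
    L (n % p) % m                      ∎

period-24-mod-18 : IsPeriodMod 18 24
period-24-mod-18 = refl , refl

-- No Lucas number is ≡ 8 (mod 18): by periodicity it suffices to inspect
-- L_0, ..., L_23, which is a finite decidable check.
L≢8-mod-18 : ∀ r → L r % 18 ≢ 8
L≢8-mod-18 r e = first-period-avoids-8 (m%n<n r 24) (trans (sym (L-mod-period 18 period-24-mod-18 r)) e)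
  where
  first-period-avoids-8 : ∀ {i} → i < 24 → L i % 18 ≢ 8
  first-period-avoids-8 = toWitness {a? = allUpTo? (λ i → ¬? (L i % 18 ≟ 8)) 24} _

pred-mod : ∀ {a b n} .{{_ : NonZero n}} → a % n ≡ suc b → (a ∸ 1) % n ≡ b
pred-mod {a} {b} {n} e = begin
  (a ∸ 1) % n              ≡⟨ cong (λ k → (k ∸ 1) % n) (trans (m≡m%n+[m/n]*n a n) (cong (_+ a / n * n) e)) ⟩
  (b + a / n * n) % n      ≡⟨ [m+kn]%n≡m%n b (a / n) n ⟩
  b % n                    ≡⟨ m<n⇒m%n≡m b<n ⟩
  b                        ∎
  where
  open ≡-Reasoning
  b<n : b < n
  b<n = ≤-trans (n≤1+n (suc b)) (subst (_< n) e (m%n<n a n))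

-- Powers 3^x with x ≥ 2 are ≡ 9 (mod 18), since 3 · 9 = 27 ≡ 9.
pow3-mod-18 : ∀ y → 3 ^ (2 + y) % 18 ≡ 9
pow3-mod-18 zero = refl
pow3-mod-18 (suc y) = begin
  (3 * 3 ^ (2 + y)) % 18             ≡⟨ %-distribˡ-* 3 (3 ^ (2 + y)) 18 ⟩
  (3 * (3 ^ (2 + y) % 18)) % 18      ≡⟨ cong (λ k → (3 * k) % 18) (pow3-mod-18 y) ⟩
  9                                  ∎
  where open ≡-Reasoning

corollary5 : (r x : ℕ) → ((3 ^ x) ∸ 1 ≡ L r) ⇔ ((r ≡ 0) × (x ≡ 1))
corollary5 r x = mk⇔ (solution x) (λ { (refl , refl) → refl })
  where
  solution : ∀ x → (3 ^ x) ∸ 1 ≡ L r → (r ≡ 0) × (x ≡ 1)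
  solution zero e = ⊥-elim (L≢0 r (sym e))
  solution (suc zero) e = L≡2⇒r≡0 r (sym e) , refl
  solution (suc (suc y)) e =
    ⊥-elim (L≢8-mod-18 r (trans (cong (_% 18) (sym e)) (pred-mod {3 ^ (2 + y)} (pow3-mod-18 y))))
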